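{- Let $2\le r<s$ be integers and let $H$ be a full $(s,s-r)$-starplus on $k>s$ vertices with excess $\lambda$ satisfying $$\lambda\le\frac{r\binom{k-s+r}{r}-(k-s+r)}{k-s}.$$ Then $H$ is $r$-balanced.
   Context: A full $(s,c)$-starplus on $k$ vertices with excess $\lambda$ is the edge-disjoint union of the full $c$-star (all $\binom{k-c}{s-c}$ $s$-subsets of the $k$-vertex set containing a fixed $c$-set $C$) and an $s$-graph with $\lambda$ edges on the same vertex set, none of which contains $C$. For an $s$-graph $H$ with $v_H\ge s$ vertices and $e_H$ edges, $f^{(r)}(H)=\frac{e_H}{v_H-s+r}$, $\mu^{(r)}(H)=\max\{f^{(r)}(H'):H'\subseteq H,\ v_{H'}\ge s\}$, and $H$ is $r$-balanced if $\mu^{(r)}(H)=f^{(r)}(H)$. -}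

module Defs where

open import Data.Nat using (ℕ; _+_; _*_; _∸_)
open import Data.Nat.Combinatorics using (_C_)
open import Data.Fin.Subset using (Subset; _⊆_; ∣_∣)
open import Data.List using (List; length)
open import Data.List.Relation.Unary.All using (All)
open import Data.List.Relation.Unary.Unique.Propositional using (Unique)
open import Data.List.Membership.Propositional using (_∈_)
open import Data.Integer using (+_)
open import Data.Rational.Unnormalised using (ℚᵘ; mkℚᵘ) renaming (_≤_ to _≤ℚ_)
open import Data.Product using (Σ; _×_)
open import Data.Sum using (_⊎_)
open import Data.Empty using (⊥)
open import Relation.Binary.PropositionalEquality using (_≡_)
open import Function.Bundles using (_⇔_)

record SGraph (s k : ℕ) : Set where
  field
    edges   : List (Subset k)
    unique  : Unique edges
    uniform : All (λ e → ∣ e ∣ ≡ s) edges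
open SGraph public

record SubGraph {s k : ℕ} (H : SGraph s k) : Set where
  field
    verts    : Subset k
    sedges   : List (Subset k)
    sunique  : Unique sedges
    sub      : ∀ {e} → e ∈ sedges → e ∈ edges H
    inside   : ∀ {e} → e ∈ sedges → e ⊆ verts
open SubGraph public

-- f^(r) of a hypergraph with v vertices and e edges (s-uniform):
-- e / (v - s + r), as an unnormalised rational mkℚᵘ num (den - 1).
-- (Only used when v ≥ s and r ≥ 1, so the denominator v - s + r is ≥ 1.)
dens : (s r v e : ℕ) → ℚᵘ
dens s r v e = mkℚᵘ (+ e) (v ∸ s + r ∸ 1)

fH : {s k : ℕ} → (r : ℕ) → SGraph s k → ℚᵘ
fH {s} {k} r H = dens s r k (length (edges H))

fSub : {s k : ℕ} → (r : ℕ) → {H : SGraph s k} → SubGraph H → ℚᵘ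
fSub {s} r H' = dens s r ∣ verts H' ∣ (length (sedges H'))

-- H is r-balanced: μ^(r)(H) = f^(r)(H), i.e. (since H ⊆ H itself attains f^(r)(H))
-- every subgraph H' with at least s vertices has f^(r)(H') ≤ f^(r)(H).
Balanced : {s k : ℕ} → (r : ℕ) → SGraph s k → Set
Balanced {s} r H = (H' : SubGraph H) → s Data.Nat.≤ ∣ verts H' ∣ → fSub r H' ≤ℚ fH r H

FullStarplus : (s c k lam : ℕ) → SGraph s k → Set
FullStarplus s c k lam H =
  Σ (Subset k) λ C → Σ (List (Subset k)) λ L →
      ∣ C ∣ ≡ c
    × Unique L
    × length L ≡ lam
    × All (λ e → ∣ e ∣ ≡ s × (C ⊆ e → ⊥)) L
    × (∀ e → (e ∈ edges H) ⇔ ((∣ e ∣ ≡ s × C ⊆ e) ⊎ e ∈ L))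

-- A subgraph H′ of H on s + i vertices has at most C(i + r, r) edges through the
-- centre C of the star (such an edge is C plus r of the i + r other vertices of H′)
-- and at most λ further edges, while H has C(d + r, r) + λ edges, where d = k − s.
-- Comparing densities thus reduces to
--   (C(i + r, r) + λ)(d + r) ≤ (C(d + r, r) + λ)(i + r),
-- which follows from the bound on λ together with the fact that
-- (C(n + r, r) − 1)/n is nondecreasing in n.
module Submission where

open import Defs hiding (inside)
open import Data.Nat using (ℕ; zero; suc; _+_; _*_; _∸_; _≤_; _<_; z≤n; s≤s; _≤′_; ≤′-refl; ≤′-step; NonZero; >-nonZero)
open import Data.Nat.Properties
open import Data.Nat.Combinatorics using (_C_; nCk+nC[k+1]≡[n+1]C[k+1]; nCn≡1)
open import Data.Nat.Tactic.RingSolver using (solve-∀)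
open import Data.Integer as ℤ using (+≤+)
open import Data.Integer.Properties using (pos-*)
open import Data.Rational.Unnormalised using (*≤*) renaming (_≤_ to _≤ℚ_)
open import Data.Vec using ([]; _∷_; here)
open import Data.Vec.Properties using (∷-injectiveˡ; ∷-injectiveʳ)
open import Data.Fin using (zero)
open import Data.Fin.Subset using (Subset; _⊆_; _∉_; ∣_∣; ⊤; inside; outside)
open import Data.Fin.Subset.Properties using (drop-∷-⊆; out⊆; in⊆in; ⊆-refl; ⊆-trans; ⊆⊤; _⊆?_; p⊆q⇒∣p∣≤∣q∣; ∣⊤∣≡n; ∣p∣≤n)
open import Data.List using (List; []; _∷_; [_]; length; map; _++_; filter)
open import Data.List.Properties using (length-map; length-++; length-removeAt′)
open import Data.List.Relation.Unary.All as All using (All; []; _∷_)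
import Data.List.Relation.Unary.All.Properties as All
open import Data.List.Relation.Unary.AllPairs using ([]; _∷_)
open import Data.List.Relation.Unary.Any using (here; there; index)
open import Data.List.Relation.Unary.Unique.Propositional using (Unique)
import Data.List.Relation.Unary.Unique.Propositional.Properties as Unique
open import Data.List.Membership.Propositional using (_∈_; _─_)
open import Data.List.Membership.Propositional.Properties using (∈-map⁺; ∈-map⁻; ∈-++⁺ˡ; ∈-++⁺ʳ; ∈-++⁻; ∈-filter⁻)
open import Data.List.Relation.Binary.Subset.Propositional using () renaming (_⊆_ to _⊆ₗ_)
open import Data.List.Relation.Binary.Disjoint.Propositional using (Disjoint)
open import Data.Product using (_×_; _,_; proj₂)
open import Data.Sum using (inj₁; inj₂)
open import Data.Empty using (⊥-elim)
open import Function using (case_of_)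
open import Function.Bundles using (Equivalence)
open import Level using (Level)
open import Relation.Binary.PropositionalEquality using (_≡_; _≢_; refl; sym; trans; cong; cong₂; subst; subst₂; module ≡-Reasoning)
open import Relation.Nullary using (yes; no)
open import Relation.Unary using (Pred; Decidable)
open import Relation.Unary.Properties using (∁?)

private variable
  ℓ : Level
  A : Set
  x y : A
  xs ys : List A
  n t : ℕ

m∸[n∸o]≡m∸n+o : ∀ {m n o} → o ≤ n → n ≤ m → m ∸ (n ∸ o) ≡ m ∸ n + o
m∸[n∸o]≡m∸n+o {m} {n} {o} o≤n n≤m = begin
  m ∸ (n ∸ o)              ≡⟨ cong (_∸ (n ∸ o)) (m∸n+n≡m n≤m) ⟨
  m ∸ n + n ∸ (n ∸ o)      ≡⟨ +-∸-assoc (m ∸ n) (m∸n≤m n o) ⟩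
  m ∸ n + (n ∸ (n ∸ o))    ≡⟨ cong (m ∸ n +_) (m∸[m∸n]≡n o≤n) ⟩
  m ∸ n + o                ∎
  where open ≡-Reasoning

suc[m+n∸1]≡m+n : ∀ m n → .{{NonZero n}} → suc (m + n ∸ 1) ≡ m + n
suc[m+n∸1]≡m+n m (suc n) = trans (cong (λ x → suc (x ∸ 1)) (+-suc m n)) (sym (+-suc m n))

∈-─⁺ : (x∈ys : x ∈ ys) → y ∈ ys → x ≢ y → y ∈ ys ─ x∈ys
∈-─⁺ (here refl)  (here refl)  x≢y = ⊥-elim (x≢y refl)
∈-─⁺ (here _)     (there y∈ys) _   = y∈ys
∈-─⁺ (there _)    (here y≡z)   _   = here y≡z
∈-─⁺ (there x∈ys) (there y∈ys) x≢y = there (∈-─⁺ x∈ys y∈ys x≢y)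

Unique-⊆⇒length≤ : Unique xs → xs ⊆ₗ ys → length xs ≤ length ys
Unique-⊆⇒length≤ []                                _     = z≤n
Unique-⊆⇒length≤ {xs = x ∷ xs} {ys} (x≢xs ∷ uniq) xs⊆ys = begin
  suc (length xs)                ≤⟨ s≤s (Unique-⊆⇒length≤ uniq xs⊆ys─x) ⟩
  suc (length (ys ─ x∈ys))       ≡⟨ length-removeAt′ ys (index x∈ys) ⟨
  length ys                      ∎
  where
  open ≤-Reasoning
  x∈ys : x ∈ ys
  x∈ys = xs⊆ys (here refl)
  xs⊆ys─x : xs ⊆ₗ ys ─ x∈ys
  xs⊆ys─x y∈xs = ∈-─⁺ x∈ys (xs⊆ys (there y∈xs)) (All.lookup x≢xs y∈xs)

length-filter+length-filter∁ : ∀ {P : Pred A ℓ} (P? : Decidable P) xs →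
  length xs ≡ length (filter P? xs) + length (filter (∁? P?) xs)
length-filter+length-filter∁ P? []       = refl
length-filter+length-filter∁ P? (x ∷ xs) with P? x
... | yes _ = cong suc (length-filter+length-filter∁ P? xs)
... | no  _ = trans (cong suc (length-filter+length-filter∁ P? xs)) (sym (+-suc (length (filter P? xs)) _))

nCk≤[n+1]Ck : ∀ n k → n C k ≤ suc n C k
nCk≤[n+1]Ck n zero    = ≤-refl
nCk≤[n+1]Ck n (suc k) = begin
  n C suc k               ≤⟨ m≤n+m _ (n C k) ⟩
  n C k + n C suc k       ≡⟨ nCk+nC[k+1]≡[n+1]C[k+1] n k ⟩
  suc n C suc k           ∎
  where open ≤-Reasoning

C-monoˡ-≤ : ∀ k {m n} → m ≤ n → m C k ≤ n C k
C-monoˡ-≤ k {m} m≤n = go (≤⇒≤′ m≤n)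
  where
  go : ∀ {n} → m ≤′ n → m C k ≤ n C k
  go ≤′-refl            = ≤-refl
  go (≤′-step {n} m≤′n) = ≤-trans (go m≤′n) (nCk≤[n+1]Ck n k)

[i+1+q]C[1+q]≤[i+1+q]Cq*i+1 : ∀ i q → (i + suc q) C suc q ≤ ((i + suc q) C q) * i + 1
[i+1+q]C[1+q]≤[i+1+q]Cq*i+1 zero    q = ≤-trans (≤-reflexive (nCn≡1 (suc q))) (m≤n+m 1 _)
[i+1+q]C[1+q]≤[i+1+q]Cq*i+1 (suc i) q = begin
  (suc i + suc q) C suc q         ≡⟨ nCk+nC[k+1]≡[n+1]C[k+1] m q ⟨
  m C q + m C suc q               ≤⟨ +-monoʳ-≤ (m C q) ([i+1+q]C[1+q]≤[i+1+q]Cq*i+1 i q) ⟩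
  m C q + ((m C q) * i + 1)       ≡⟨ regroup (m C q) i ⟩
  (m C q) * suc i + 1             ≤⟨ +-monoˡ-≤ 1 (*-monoˡ-≤ (suc i) (nCk≤[n+1]Ck m q)) ⟩
  (suc m C q) * suc i + 1         ∎
  where
  open ≤-Reasoning
  m : ℕ
  m = i + suc q
  regroup : ∀ x i → x + (x * i + 1) ≡ x * suc i + 1
  regroup = solve-∀

-- (C(n + r, r) − 1)/n is nondecreasing in n, with denominators cleared.
[i+r]Cr*[i+j]≤[i+j+r]Cr*i+j : ∀ r i j → ((i + r) C r) * (i + j) ≤ ((i + j + r) C r) * i + j
[i+r]Cr*[i+j]≤[i+j+r]Cr*i+j zero    i j =
  ≤-reflexive (trans (*-identityˡ (i + j)) (cong (_+ j) (sym (*-identityˡ i))))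
[i+r]Cr*[i+j]≤[i+j+r]Cr*i+j (suc q) i zero
  rewrite +-identityʳ i | +-identityʳ (((i + suc q) C suc q) * i) = ≤-refl
[i+r]Cr*[i+j]≤[i+j+r]Cr*i+j (suc q) i (suc j) = begin
  X * (i + suc j)                   ≡⟨ cong (X *_) (+-suc i j) ⟩
  X * suc (i + j)                   ≡⟨ *-suc X (i + j) ⟩
  X + X * (i + j)                   ≤⟨ +-mono-≤ ([i+1+q]C[1+q]≤[i+1+q]Cq*i+1 i q) ([i+r]Cr*[i+j]≤[i+j+r]Cr*i+j (suc q) i j) ⟩
  ((i + suc q) C q) * i + 1 + ((m C suc q) * i + j)
      ≤⟨ +-monoˡ-≤ _ (+-monoˡ-≤ 1 (*-monoˡ-≤ i (C-monoˡ-≤ q (+-monoˡ-≤ (suc q) (m≤m+n i j))))) ⟩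
  (m C q) * i + 1 + ((m C suc q) * i + j)      ≡⟨ regroup (m C q) (m C suc q) i j ⟩
  (m C q + m C suc q) * i + suc j   ≡⟨ cong (λ x → x * i + suc j) (nCk+nC[k+1]≡[n+1]C[k+1] m q) ⟩
  (suc m C suc q) * i + suc j       ≡⟨ cong (λ x → (x C suc q) * i + suc j) (cong (_+ suc q) (+-suc i j)) ⟨
  ((i + suc j + suc q) C suc q) * i + suc j ∎
  where
  open ≤-Reasoning
  X m : ℕ
  X = (i + suc q) C suc q
  m = i + j + suc q
  regroup : ∀ x y i j → x * i + 1 + (y * i + j) ≡ (x + y) * i + suc j
  regroup = solve-∀

starplus-density-≤ : ∀ r lam {i d} → i ≤ d → .{{NonZero d}} →
  lam * d + (d + r) ≤ r * ((d + r) C r) →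
  ((i + r) C r + lam) * (d + r) ≤ ((d + r) C r + lam) * (i + r)
starplus-density-≤ r lam {i} i≤d hyp with m≤n⇒∃[o]m+o≡n i≤d
... | j , refl = +-cancelʳ-≤ j _ _ (begin
  (X + lam) * (d + r) + j                  ≡⟨ split-left X lam i j r ⟩
  (X * r + lam * j + j) + X * d + lam * (i + r)
                                           ≤⟨ +-monoˡ-≤ (lam * (i + r)) (+-mono-≤ star-share gap) ⟩
  N * r + (N * i + j) + lam * (i + r)      ≡⟨ split-right N lam i j r ⟩
  (N + lam) * (i + r) + j                  ∎)
  where
  open ≤-Reasoning
  d X N : ℕ
  d = i + j
  X = (i + r) C r
  N = (d + r) C r
  gap : X * d ≤ N * i + j
  gap = [i+r]Cr*[i+j]≤[i+j+r]Cr*i+j r i j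
  star-share : X * r + lam * j + j ≤ N * r
  star-share = *-cancelˡ-≤ d (+-cancelʳ-≤ (r * j) _ _ (begin
    d * (X * r + lam * j + j) + r * j      ≡⟨ expand-left X lam i j r ⟩
    r * (X * d) + j * (lam * d + (d + r))  ≤⟨ +-mono-≤ (*-monoʳ-≤ r gap) (*-monoʳ-≤ j hyp) ⟩
    r * (N * i + j) + j * (r * N)          ≡⟨ expand-right N i j r ⟩
    d * (N * r) + r * j                    ∎))
    where
    expand-left : ∀ X lam i j r → (i + j) * (X * r + lam * j + j) + r * j ≡ r * (X * (i + j)) + j * (lam * (i + j) + (i + j + r))
    expand-left = solve-∀
    expand-right : ∀ N i j r → r * (N * i + j) + j * (r * N) ≡ (i + j) * (N * r) + r * j
    expand-right = solve-∀
  split-left : ∀ X lam i j r → (X + lam) * (i + j + r) + j ≡ (X * r + lam * j + j) + X * (i + j) + lam * (i + r)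
  split-left = solve-∀
  split-right : ∀ N lam i j r → N * r + (N * i + j) + lam * (i + r) ≡ (N + lam) * (i + r) + j
  split-right = solve-∀

Between : Subset n → Subset n → ℕ → Subset n → Set
Between p q t e = p ⊆ e × e ⊆ q × ∣ e ∣ ≡ ∣ p ∣ + t

between : Subset n → Subset n → ℕ → List (Subset n)
between []            []            zero    = [ [] ]
between []            []            (suc t) = []
between (inside ∷ p)  (inside ∷ q)  t       = map (inside ∷_) (between p q t)
between (inside ∷ p)  (outside ∷ q) t       = []
between (outside ∷ p) (outside ∷ q) t       = map (outside ∷_) (between p q t)
between (outside ∷ p) (inside ∷ q)  zero    = map (outside ∷_) (between p q zero)
between (outside ∷ p) (inside ∷ q)  (suc t) =
  map (inside ∷_) (between p q t) ++ map (outside ∷_) (between p q (suc t))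

Between-inside : ∀ {p q e : Subset n} → Between p q t e → Between (inside ∷ p) (inside ∷ q) t (inside ∷ e)
Between-inside (p⊆e , e⊆q , ∣e∣) = in⊆in p⊆e , in⊆in e⊆q , cong suc ∣e∣

Between-outside : ∀ {p q e : Subset n} b → Between p q t e → Between (outside ∷ p) (b ∷ q) t (outside ∷ e)
Between-outside _ (p⊆e , e⊆q , ∣e∣) = out⊆ p⊆e , out⊆ e⊆q , ∣e∣

Between-added : ∀ {p q e : Subset n} → Between p q t e → Between (outside ∷ p) (inside ∷ q) (suc t) (inside ∷ e)
Between-added {p = p} (p⊆e , e⊆q , ∣e∣) = out⊆ p⊆e , in⊆in e⊆q , trans (cong suc ∣e∣) (sym (+-suc ∣ p ∣ _))

between-sound : ∀ (p q : Subset n) t → All (Between p q t) (between p q t)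
between-sound []            []            zero    = (⊆-refl , ⊆-refl , refl) ∷ []
between-sound []            []            (suc t) = []
between-sound (inside ∷ p)  (inside ∷ q)  t       = All.map⁺ (All.map Between-inside (between-sound p q t))
between-sound (inside ∷ p)  (outside ∷ q) t       = []
between-sound (outside ∷ p) (outside ∷ q) t       = All.map⁺ (All.map (Between-outside _) (between-sound p q t))
between-sound (outside ∷ p) (inside ∷ q)  zero    = All.map⁺ (All.map (Between-outside _) (between-sound p q zero))
between-sound (outside ∷ p) (inside ∷ q)  (suc t) = All.++⁺
  (All.map⁺ (All.map Between-added (between-sound p q t)))
  (All.map⁺ (All.map (Between-outside _) (between-sound p q (suc t))))

Between-inside⁻ : ∀ {p q e : Subset n} → Between (inside ∷ p) (inside ∷ q) t (inside ∷ e) → Between p q t e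
Between-inside⁻ (p⊆e , e⊆q , ∣e∣) = drop-∷-⊆ p⊆e , drop-∷-⊆ e⊆q , suc-injective ∣e∣

Between-outside⁻ : ∀ {p q e : Subset n} {b} → Between (outside ∷ p) (b ∷ q) t (outside ∷ e) → Between p q t e
Between-outside⁻ (p⊆e , e⊆q , ∣e∣) = drop-∷-⊆ p⊆e , drop-∷-⊆ e⊆q , ∣e∣

Between-added⁻ : ∀ {p q e : Subset n} → Between (outside ∷ p) (inside ∷ q) (suc t) (inside ∷ e) → Between p q t e
Between-added⁻ {p = p} (p⊆e , e⊆q , ∣e∣) =
  drop-∷-⊆ p⊆e , drop-∷-⊆ e⊆q , suc-injective (trans ∣e∣ (+-suc ∣ p ∣ _))

zero∉outside∷ : ∀ {p : Subset n} → zero ∉ outside ∷ p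
zero∉outside∷ ()

between-complete : ∀ (p q : Subset n) t {e} → Between p q t e → e ∈ between p q t
between-complete []            []            zero    {[]}          _             = here refl
between-complete []            []            (suc t) {[]}          (_ , _ , ())
between-complete (inside ∷ p)  (inside ∷ q)  t       {inside ∷ e}  b             =
  ∈-map⁺ (inside ∷_) (between-complete p q t (Between-inside⁻ b))
between-complete (inside ∷ p)  q             t       {outside ∷ e} (p⊆e , _)     = ⊥-elim (zero∉outside∷ (p⊆e here))
between-complete (outside ∷ p) (outside ∷ q) t       {outside ∷ e} b             =
  ∈-map⁺ (outside ∷_) (between-complete p q t (Between-outside⁻ b))
between-complete p             (outside ∷ q) t       {inside ∷ e}  (_ , e⊆q , _) = ⊥-elim (zero∉outside∷ (e⊆q here))
between-complete (outside ∷ p) (inside ∷ q)  zero    {inside ∷ e}  (p⊆e , _ , ∣e∣) =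
  ⊥-elim (1+n≰n (≤-trans (≤-reflexive (trans ∣e∣ (+-identityʳ ∣ p ∣))) (p⊆q⇒∣p∣≤∣q∣ (drop-∷-⊆ p⊆e))))
between-complete (outside ∷ p) (inside ∷ q)  zero    {outside ∷ e} b             =
  ∈-map⁺ (outside ∷_) (between-complete p q zero (Between-outside⁻ b))
between-complete (outside ∷ p) (inside ∷ q)  (suc t) {inside ∷ e}  b             =
  ∈-++⁺ˡ (∈-map⁺ (inside ∷_) (between-complete p q t (Between-added⁻ b)))
between-complete (outside ∷ p) (inside ∷ q)  (suc t) {outside ∷ e} b             =
  ∈-++⁺ʳ _ (∈-map⁺ (outside ∷_) (between-complete p q (suc t) (Between-outside⁻ b)))

between-unique : ∀ (p q : Subset n) t → Unique (between p q t)
between-unique []            []            zero    = [] ∷ []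
between-unique []            []            (suc t) = []
between-unique (inside ∷ p)  (inside ∷ q)  t       = Unique.map⁺ ∷-injectiveʳ (between-unique p q t)
between-unique (inside ∷ p)  (outside ∷ q) t       = []
between-unique (outside ∷ p) (outside ∷ q) t       = Unique.map⁺ ∷-injectiveʳ (between-unique p q t)
between-unique (outside ∷ p) (inside ∷ q)  zero    = Unique.map⁺ ∷-injectiveʳ (between-unique p q zero)
between-unique (outside ∷ p) (inside ∷ q)  (suc t) =
  Unique.++⁺ (Unique.map⁺ ∷-injectiveʳ (between-unique p q t))
             (Unique.map⁺ ∷-injectiveʳ (between-unique p q (suc t)))
             heads-differ
  where
  heads-differ : Disjoint (map (inside ∷_) (between p q t)) (map (outside ∷_) (between p q (suc t)))
  heads-differ (e∈ˡ , e∈ʳ) with ∈-map⁻ (inside ∷_) e∈ˡ | ∈-map⁻ (outside ∷_) e∈ʳ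
  ... | _ , _ , refl | _ , _ , e≡ = case ∷-injectiveˡ e≡ of λ ()

length-between : ∀ (p q : Subset n) t → p ⊆ q → length (between p q t) ≡ (∣ q ∣ ∸ ∣ p ∣) C t
length-between []            []            zero    _   = refl
length-between []            []            (suc t) _   = refl
length-between (inside ∷ p)  (inside ∷ q)  t       p⊆q =
  trans (length-map (inside ∷_) (between p q t)) (length-between p q t (drop-∷-⊆ p⊆q))
length-between (inside ∷ p)  (outside ∷ q) t       p⊆q = ⊥-elim (zero∉outside∷ (p⊆q here))
length-between (outside ∷ p) (outside ∷ q) t       p⊆q =
  trans (length-map (outside ∷_) (between p q t)) (length-between p q t (drop-∷-⊆ p⊆q))
length-between (outside ∷ p) (inside ∷ q)  zero    p⊆q =
  trans (length-map (outside ∷_) (between p q zero)) (length-between p q zero (drop-∷-⊆ p⊆q))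
length-between (outside ∷ p) (inside ∷ q)  (suc t) p⊆q = begin
  length (map (inside ∷_) (between p q t) ++ map (outside ∷_) (between p q (suc t)))
    ≡⟨ length-++ (map (inside ∷_) (between p q t)) ⟩
  length (map (inside ∷_) (between p q t)) + length (map (outside ∷_) (between p q (suc t)))
    ≡⟨ cong₂ _+_ (length-map (inside ∷_) (between p q t)) (length-map (outside ∷_) (between p q (suc t))) ⟩
  length (between p q t) + length (between p q (suc t))
    ≡⟨ cong₂ _+_ (length-between p q t (drop-∷-⊆ p⊆q)) (length-between p q (suc t) (drop-∷-⊆ p⊆q)) ⟩
  (∣ q ∣ ∸ ∣ p ∣) C t + (∣ q ∣ ∸ ∣ p ∣) C suc t
    ≡⟨ nCk+nC[k+1]≡[n+1]C[k+1] (∣ q ∣ ∸ ∣ p ∣) t ⟩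
  suc (∣ q ∣ ∸ ∣ p ∣) C suc t
    ≡⟨ cong (_C suc t) (+-∸-assoc 1 (p⊆q⇒∣p∣≤∣q∣ (drop-∷-⊆ p⊆q))) ⟨
  (suc ∣ q ∣ ∸ ∣ p ∣) C suc t ∎
  where open ≡-Reasoning

Unique-Between⇒length≤ : ∀ {p q : Subset n} {xs} → Unique xs → (∀ {e} → e ∈ xs → Between p q t e) →
  length xs ≤ (∣ q ∣ ∸ ∣ p ∣) C t
Unique-Between⇒length≤ {t = t} {p = p} {q} {xs} uniq in-between with p ⊆? q
... | yes p⊆q = begin
  length xs                  ≤⟨ Unique-⊆⇒length≤ uniq (λ e∈xs → between-complete p q t (in-between e∈xs)) ⟩
  length (between p q t)     ≡⟨ length-between p q t p⊆q ⟩
  (∣ q ∣ ∸ ∣ p ∣) C t        ∎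
  where open ≤-Reasoning
... | no p⊈q with xs | in-between
...   | []    | _        = z≤n
...   | _ ∷ _ | in-between = let (p⊆e , e⊆q , _) = in-between (here refl) in ⊥-elim (p⊈q (⊆-trans p⊆e e⊆q))

module _ {s c k lam : ℕ} {H : SGraph s k} (c≤s : c ≤ s) where

  FullStarplus⇒length-edges≥ : FullStarplus s c k lam H → (k ∸ c) C (s ∸ c) + lam ≤ length (edges H)
  FullStarplus⇒length-edges≥ (C₀ , L , ∣C∣≡c , uniqueL , ∣L∣≡lam , Lspec , edgesH) = begin
    (k ∸ c) C u + lam             ≡⟨ cong₂ _+_ star-size ∣L∣≡lam ⟨
    length star + length L        ≡⟨ length-++ star ⟨
    length (star ++ L)            ≤⟨ Unique-⊆⇒length≤ (Unique.++⁺ (between-unique C₀ ⊤ u) uniqueL star∩L≡∅) star∪L⊆H ⟩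
    length (edges H)              ∎
    where
    open ≤-Reasoning
    u : ℕ
    u = s ∸ c
    star : List (Subset k)
    star = between C₀ ⊤ u
    star-size : length star ≡ (k ∸ c) C u
    star-size = trans (length-between C₀ ⊤ u ⊆⊤) (cong₂ (λ a b → (a ∸ b) C u) (∣⊤∣≡n k) ∣C∣≡c)
    in-star : ∀ {e} → e ∈ star → ∣ e ∣ ≡ s × C₀ ⊆ e
    in-star e∈star with All.lookup (between-sound C₀ ⊤ u) e∈star
    ... | C⊆e , _ , ∣e∣ = trans ∣e∣ (trans (cong (_+ u) ∣C∣≡c) (m+[n∸m]≡n c≤s)) , C⊆e
    star∩L≡∅ : Disjoint star L
    star∩L≡∅ (e∈star , e∈L) = proj₂ (All.lookup Lspec e∈L) (proj₂ (in-star e∈star))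
    star∪L⊆H : star ++ L ⊆ₗ edges H
    star∪L⊆H {e} e∈ with ∈-++⁻ star e∈
    ... | inj₁ e∈star = Equivalence.from (edgesH e) (inj₁ (in-star e∈star))
    ... | inj₂ e∈L    = Equivalence.from (edgesH e) (inj₂ e∈L)

  FullStarplus⇒length-sedges≤ : FullStarplus s c k lam H → (H′ : SubGraph H) →
    length (sedges H′) ≤ (∣ verts H′ ∣ ∸ c) C (s ∸ c) + lam
  FullStarplus⇒length-sedges≤ (C₀ , L , ∣C∣≡c , uniqueL , ∣L∣≡lam , Lspec , edgesH) H′ = begin
    length E′                                         ≡⟨ length-filter+length-filter∁ (C₀ ⊆?_) E′ ⟩
    length (filter (C₀ ⊆?_) E′) + length (filter (∁? (C₀ ⊆?_)) E′) ≤⟨ +-mono-≤ through-C avoiding-C ⟩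
    (∣ verts H′ ∣ ∸ c) C u + lam                      ∎
    where
    open ≤-Reasoning
    u : ℕ
    u = s ∸ c
    E′ : List (Subset k)
    E′ = sedges H′
    in-between : ∀ {e} → e ∈ filter (C₀ ⊆?_) E′ → Between C₀ (verts H′) u e
    in-between e∈ with ∈-filter⁻ (C₀ ⊆?_) e∈
    ... | e∈E′ , C⊆e = C⊆e , SubGraph.inside H′ e∈E′ ,
      trans (All.lookup (uniform H) (sub H′ e∈E′)) (sym (trans (cong (_+ u) ∣C∣≡c) (m+[n∸m]≡n c≤s)))
    through-C : length (filter (C₀ ⊆?_) E′) ≤ (∣ verts H′ ∣ ∸ c) C u
    through-C = subst (λ a → _ ≤ (∣ verts H′ ∣ ∸ a) C u) ∣C∣≡c
      (Unique-Between⇒length≤ (Unique.filter⁺ (C₀ ⊆?_) (sunique H′)) in-between)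
    avoiding-C : length (filter (∁? (C₀ ⊆?_)) E′) ≤ lam
    avoiding-C = subst (_ ≤_) ∣L∣≡lam (Unique-⊆⇒length≤ (Unique.filter⁺ (∁? (C₀ ⊆?_)) (sunique H′)) in-L)
      where
      in-L : filter (∁? (C₀ ⊆?_)) E′ ⊆ₗ L
      in-L {e} e∈ with ∈-filter⁻ (∁? (C₀ ⊆?_)) e∈
      ... | e∈E′ , C⊈e with Equivalence.to (edgesH e) (sub H′ e∈E′)
      ...   | inj₁ (_ , C⊆e) = ⊥-elim (C⊈e C⊆e)
      ...   | inj₂ e∈L       = e∈L

dens-≤ : ∀ s r v v′ {e e′} → .{{NonZero r}} →
  e * (v′ ∸ s + r) ≤ e′ * (v ∸ s + r) → dens s r v e ≤ℚ dens s r v′ e′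
dens-≤ s r v v′ {e} {e′} le = *≤* (subst₂ ℤ._≤_ (pos-* e _) (pos-* e′ _) (+≤+ (subst₂ _≤_
  (cong (e *_) (sym (suc[m+n∸1]≡m+n (v′ ∸ s) r))) (cong (e′ *_) (sym (suc[m+n∸1]≡m+n (v ∸ s) r))) le)))

proposition4 : (r s k lam : ℕ) → 2 ≤ r → r < s → s < k →
    (H : SGraph s k) → FullStarplus s (s ∸ r) k lam H →
    lam * (k ∸ s) + (k ∸ s + r) ≤ r * ((k ∸ s + r) C r) →
    Balanced r H
proposition4 r s k lam 2≤r r<s s<k H starplus hyp H′ s≤w = dens-≤ s r w k {{r≢0}} (begin
  length (sedges H′) * (d + r)            ≤⟨ *-monoˡ-≤ (d + r) (FullStarplus⇒length-sedges≤ c≤s starplus H′) ⟩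
  ((w ∸ c) C (s ∸ c) + lam) * (d + r)     ≡⟨ cong (λ x → (x + lam) * (d + r)) (recentre s≤w) ⟩
  ((i + r) C r + lam) * (d + r)           ≤⟨ starplus-density-≤ r lam (∸-monoˡ-≤ s (∣p∣≤n (verts H′))) {{d≢0}} hyp ⟩
  ((d + r) C r + lam) * (i + r)           ≡⟨ cong (λ x → (x + lam) * (i + r)) (recentre (<⇒≤ s<k)) ⟨
  ((k ∸ c) C (s ∸ c) + lam) * (i + r)     ≤⟨ *-monoˡ-≤ (i + r) (FullStarplus⇒length-edges≥ {H = H} c≤s starplus) ⟩
  length (edges H) * (i + r)              ∎)
  where
  open ≤-Reasoning
  c w i d : ℕ
  c = s ∸ r
  w = ∣ verts H′ ∣
  i = w ∸ s
  d = k ∸ s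
  c≤s : c ≤ s
  c≤s = m∸n≤m s r
  r≢0 : NonZero r
  r≢0 = >-nonZero (≤-trans (s≤s z≤n) 2≤r)
  d≢0 : NonZero d
  d≢0 = >-nonZero (m<n⇒0<n∸m s<k)
  recentre : ∀ {v} → s ≤ v → (v ∸ c) C (s ∸ c) ≡ (v ∸ s + r) C r
  recentre s≤v = cong₂ _C_ (m∸[n∸o]≡m∸n+o (<⇒≤ r<s) s≤v) (m∸[m∸n]≡n (<⇒≤ r<s))
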